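{- Let $\alpha,\beta\ge 0$ be integers with $\alpha$ odd, and let $k\ge 1$. Then $$\nu_2\big(F(\alpha,\beta,k)\big)=\begin{cases}k+1 & \text{if } \beta \text{ is even},\\ k & \text{if } \beta\text{ is odd}.\end{cases}$$
   Context: For integers $\alpha,\beta\ge 0$ and $k\ge 1$, $$F(\alpha,\beta,k)=\sum_{j=0}^{2k-1}(2j+\alpha)^{\beta}\,\frac{(2j)!}{j!\,2^j}\binom{4k-1}{2j}.$$ $\nu_2(x)$ denotes the exponent of the highest power of $2$ dividing the nonzero integer $x$. -}

module Defs where

open import Data.Nat.Base using (ℕ; zero; suc; _+_; _*_; _^_; _/_; _!; NonZero)
open import Data.Nat.Divisibility using (_∣_)
open import Data.Nat.Combinatorics using (_C_)
open import Data.Nat.Properties using (m^n≢0; m*n≢0; _!≢0)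
open import Data.Product using (_×_)
open import Relation.Nullary using (¬_)

sumBelow : ℕ → (ℕ → ℕ) → ℕ
sumBelow zero    f = 0
sumBelow (suc n) f = sumBelow n f + f n

private
  den≢0 : ∀ j → NonZero ((j !) * (2 ^ j))
  den≢0 j = m*n≢0 (j !) (2 ^ j) ⦃ j !≢0 ⦄ ⦃ m^n≢0 2 j ⦄

-- (2j)! / (j! 2^j)  (an exact division)
ratio : ℕ → ℕ
ratio j = _/_ ((2 * j) !) ((j !) * (2 ^ j)) ⦃ den≢0 j ⦄

F : ℕ → ℕ → ℕ → ℕ
F α β k = sumBelow (2 * k) (λ j → ((2 * j + α) ^ β) * ratio j * ((4 * k ∸ 1) C (2 * j)))
  where open import Data.Nat.Base using (_∸_)

-- "ν₂(x) = e" : 2^e divides x and 2^(e+1) does not (this forces x ≠ 0)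
ν₂≡ : ℕ → ℕ → Set
ν₂≡ x e = (2 ^ e ∣ x) × ¬ (2 ^ suc e ∣ x)

-- involutions n j = (2j−1)!! C(n,2j) counts the involutions of an n-set with j two-cycles, and
-- F α β k = moment (4k−1) α β. Deleting the last point of the set gives the telephone recurrence
-- for telephone n = moment n α 0 and, for the moments,
--   moment (n+2) α (β+1) = α · moment (n+2) α β + (n+2)(n+1) · moment n (α+2) β.
-- The first yields ν₂ (telephone (4a+1)) = a and ν₂ (telephone (4a+3)) = a+2. The second yields
-- 2^a ∣ moment (4a+1) α β and 2^(a+1) ∣ moment (4a+3) α β, and then, for odd α,
-- moment (4a+3) α (β+2) ≡ moment (4a+3) α β (mod 2^(a+3)). So ν₂ (moment (4a+3) α β) depends
-- only on the parity of β, and the cases β = 0 and β = 1 give a+2 and a+1.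
module Submission where

open import Defs
open import Data.Nat.Base using (ℕ; suc; _≥_; _+_; _%_)
open import Data.Product using (_×_)
open import Relation.Binary.PropositionalEquality using (_≡_)

open import Data.Nat.Base using (zero; s≤s; z≤n; _*_; _^_; _∸_; _/_; _!; _≤_; _<_; _≤′_; ≤′-refl; ≤′-step; NonZero)
open import Data.Nat.Properties
open import Data.Nat.Combinatorics using (_C_; nCk+nC[k+1]≡[n+1]C[k+1]; nC1≡n; k>n⇒nCk≡0)
open import Data.Nat.DivMod using (m*n/n≡m; m≡m%n+[m/n]*n)
open import Data.Nat.Divisibility
  using (_∣_; divides; 1∣_; _∣0; ∣-refl; ∣-trans; m∣m*n; n∣m*n; ∣m∣n⇒∣m+n; ∣m+n∣m⇒∣n; *-cancelˡ-∣; *-pres-∣)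
open import Data.Nat.Tactic.RingSolver using (solve-∀)
open import Data.Product using (_,_; proj₁; proj₂; ∃-syntax)
open import Relation.Nullary using (¬_)
open import Relation.Binary.PropositionalEquality
  using (refl; sym; trans; cong; cong₂; subst; subst₂; module ≡-Reasoning)
open ≡-Reasoning

sumBelow-cong : ∀ N {f g : ℕ → ℕ} → (∀ j → f j ≡ g j) → sumBelow N f ≡ sumBelow N g
sumBelow-cong zero    f≡g = refl
sumBelow-cong (suc N) f≡g = cong₂ _+_ (sumBelow-cong N f≡g) (f≡g N)

sumBelow-+ : ∀ N (f g : ℕ → ℕ) → sumBelow N (λ j → f j + g j) ≡ sumBelow N f + sumBelow N g
sumBelow-+ zero    f g = refl
sumBelow-+ (suc N) f g = trans (cong (_+ (f N + g N)) (sumBelow-+ N f g)) (interchange (sumBelow N f) (sumBelow N g) (f N) (g N))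
  where
  interchange : ∀ a b c d → a + b + (c + d) ≡ a + c + (b + d)
  interchange = solve-∀

sumBelow-*ˡ : ∀ N c (f : ℕ → ℕ) → sumBelow N (λ j → c * f j) ≡ c * sumBelow N f
sumBelow-*ˡ zero    c f = sym (*-zeroʳ c)
sumBelow-*ˡ (suc N) c f = trans (cong (_+ c * f N) (sumBelow-*ˡ N c f)) (sym (*-distribˡ-+ c (sumBelow N f) (f N)))

sumBelow-suc : ∀ N (f : ℕ → ℕ) → sumBelow (suc N) f ≡ f 0 + sumBelow N (λ j → f (suc j))
sumBelow-suc zero    f = +-comm 0 (f 0)
sumBelow-suc (suc N) f = trans (cong (_+ f (suc N)) (sumBelow-suc N f)) (+-assoc (f 0) _ _)

sumBelow-stable : ∀ (f : ℕ → ℕ) {N N′} → (∀ {j} → N ≤ j → f j ≡ 0) → N ≤ N′ → sumBelow N′ f ≡ sumBelow N f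
sumBelow-stable f {N} vanish N≤N′ = go (≤⇒≤′ N≤N′)
  where
  go : ∀ {N′} → N ≤′ N′ → sumBelow N′ f ≡ sumBelow N f
  go ≤′-refl            = refl
  go (≤′-step N≤′N′) = trans (cong₂ _+_ (go N≤′N′) (vanish (≤′⇒≤ N≤′N′))) (+-identityʳ _)

oddFactorial : ℕ → ℕ
oddFactorial zero    = 1
oddFactorial (suc j) = (1 + 2 * j) * oddFactorial j

[2j]!≡oddFactorial*j!*2^j : ∀ j → (2 * j) ! ≡ oddFactorial j * (j ! * 2 ^ j)
[2j]!≡oddFactorial*j!*2^j zero    = refl
[2j]!≡oddFactorial*j!*2^j (suc j) = begin
  (2 * suc j) !                                      ≡⟨ cong _! (*-suc 2 j) ⟩
  (2 + 2 * j) * ((1 + 2 * j) * (2 * j) !)            ≡⟨ cong (λ x → (2 + 2 * j) * ((1 + 2 * j) * x)) ([2j]!≡oddFactorial*j!*2^j j) ⟩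
  (2 + 2 * j) * ((1 + 2 * j) * (oddFactorial j * (j ! * 2 ^ j)))
    ≡⟨ regroup j (oddFactorial j) (j !) (2 ^ j) ⟩
  (1 + 2 * j) * oddFactorial j * (suc j * j ! * (2 * 2 ^ j)) ∎
  where
  regroup : ∀ j d f p → (2 + 2 * j) * ((1 + 2 * j) * (d * (f * p))) ≡ (1 + 2 * j) * d * ((1 + j) * f * (2 * p))
  regroup = solve-∀

ratio≡oddFactorial : ∀ j → ratio j ≡ oddFactorial j
ratio≡oddFactorial j = begin
  ((2 * j) ! / (j ! * 2 ^ j)) ⦃ _ ⦄              ≡⟨ cong (λ x → (x / (j ! * 2 ^ j)) ⦃ j!*2^j≢0 ⦄) ([2j]!≡oddFactorial*j!*2^j j) ⟩
  (oddFactorial j * (j ! * 2 ^ j) / (j ! * 2 ^ j)) ⦃ _ ⦄ ≡⟨ m*n/n≡m (oddFactorial j) (j ! * 2 ^ j) ⦃ j!*2^j≢0 ⦄ ⟩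
  oddFactorial j ∎
  where
  j!*2^j≢0 : NonZero (j ! * 2 ^ j)
  j!*2^j≢0 = m*n≢0 (j !) (2 ^ j) ⦃ j !≢0 ⦄ ⦃ m^n≢0 2 j ⦄

[1+k]*[1+n]C[1+k]≡[1+n]*nCk : ∀ n k → suc k * (suc n C suc k) ≡ suc n * (n C k)
[1+k]*[1+n]C[1+k]≡[1+n]*nCk zero zero = refl
[1+k]*[1+n]C[1+k]≡[1+n]*nCk zero (suc k)
  rewrite k>n⇒nCk≡0 {1} {2 + k} (s≤s (s≤s z≤n)) | k>n⇒nCk≡0 {0} {suc k} (s≤s z≤n) = *-zeroʳ (2 + k)
[1+k]*[1+n]C[1+k]≡[1+n]*nCk (suc n) zero
  rewrite nC1≡n (2 + n) = trans (*-identityˡ _) (sym (*-identityʳ _))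
[1+k]*[1+n]C[1+k]≡[1+n]*nCk (suc n) (suc k) = begin
  (2 + k) * ((2 + n) C (2 + k))                            ≡⟨ cong ((2 + k) *_) (sym (nCk+nC[k+1]≡[n+1]C[k+1] (suc n) (suc k))) ⟩
  (2 + k) * (suc n C suc k + suc n C (2 + k))             ≡⟨ split k (suc n C suc k) (suc n C (2 + k)) ⟩
  suc n C suc k + ((1 + k) * (suc n C suc k) + (2 + k) * (suc n C (2 + k)))
    ≡⟨ cong (suc n C suc k +_) (cong₂ _+_ ([1+k]*[1+n]C[1+k]≡[1+n]*nCk n k) ([1+k]*[1+n]C[1+k]≡[1+n]*nCk n (suc k))) ⟩
  suc n C suc k + ((1 + n) * (n C k) + (1 + n) * (n C suc k))
    ≡⟨ cong (suc n C suc k +_) (sym (*-distribˡ-+ (1 + n) (n C k) (n C suc k))) ⟩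
  suc n C suc k + (1 + n) * (n C k + n C suc k)           ≡⟨ cong (λ x → suc n C suc k + (1 + n) * x) (nCk+nC[k+1]≡[n+1]C[k+1] n k) ⟩
  (2 + n) * (suc n C suc k) ∎
  where
  split : ∀ k x y → (2 + k) * (x + y) ≡ x + ((1 + k) * x + (2 + k) * y)
  split = solve-∀

involutions : ℕ → ℕ → ℕ
involutions n j = oddFactorial j * (n C (2 * j))

involutions-vanish : ∀ {n j} → n < 2 * j → involutions n j ≡ 0
involutions-vanish {n} {j} n<2j = trans (cong (oddFactorial j *_) (k>n⇒nCk≡0 n<2j)) (*-zeroʳ (oddFactorial j))

involutions-suc : ∀ n j → involutions (2 + n) (suc j) ≡ involutions (suc n) (suc j) + suc n * involutions n j
involutions-suc n j = begin
  a * d * ((2 + n) C (2 * suc j))                              ≡⟨ cong (λ i → a * d * ((2 + n) C i)) (*-suc 2 j) ⟩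
  a * d * ((2 + n) C (2 + 2 * j))                              ≡⟨ cong (a * d *_) (sym (nCk+nC[k+1]≡[n+1]C[k+1] (suc n) a)) ⟩
  a * d * (suc n C a + suc n C (2 + 2 * j))                    ≡⟨ distribute a d (suc n C a) (suc n C (2 + 2 * j)) ⟩
  d * (a * (suc n C a)) + a * d * (suc n C (2 + 2 * j))
    ≡⟨ cong₂ (λ x i → d * x + a * d * (suc n C i)) ([1+k]*[1+n]C[1+k]≡[1+n]*nCk n (2 * j)) (sym (*-suc 2 j)) ⟩
  d * (suc n * (n C (2 * j))) + involutions (suc n) (suc j)   ≡⟨ rearrange d (suc n) (n C (2 * j)) (involutions (suc n) (suc j)) ⟩
  involutions (suc n) (suc j) + suc n * involutions n j ∎
  where
  a = 1 + 2 * j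
  d = oddFactorial j
  distribute : ∀ a d x y → a * d * (x + y) ≡ d * (a * x) + a * d * y
  distribute = solve-∀
  rearrange : ∀ d m x y → d * (m * x) + y ≡ y + m * (d * x)
  rearrange = solve-∀

involutions-absorb : ∀ n j → 2 * suc j * involutions (2 + n) (suc j) ≡ (2 + n) * suc n * involutions n j
involutions-absorb n j = begin
  2 * suc j * (a * d * ((2 + n) C (2 * suc j)))               ≡⟨ cong (λ i → 2 * suc j * (a * d * ((2 + n) C i))) (*-suc 2 j) ⟩
  2 * suc j * (a * d * ((2 + n) C (2 + 2 * j)))               ≡⟨ regroup j d ((2 + n) C (2 + 2 * j)) ⟩
  d * (a * ((2 + 2 * j) * ((2 + n) C (2 + 2 * j))))           ≡⟨ cong (λ x → d * (a * x)) ([1+k]*[1+n]C[1+k]≡[1+n]*nCk (suc n) a) ⟩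
  d * (a * ((2 + n) * (suc n C a)))                            ≡⟨ swap d a (2 + n) (suc n C a) ⟩
  d * ((2 + n) * (a * (suc n C a)))                            ≡⟨ cong (λ x → d * ((2 + n) * x)) ([1+k]*[1+n]C[1+k]≡[1+n]*nCk n (2 * j)) ⟩
  d * ((2 + n) * (suc n * (n C (2 * j))))                      ≡⟨ pull d (2 + n) (suc n) (n C (2 * j)) ⟩
  (2 + n) * suc n * involutions n j ∎
  where
  a = 1 + 2 * j
  d = oddFactorial j
  regroup : ∀ j d x → 2 * suc j * ((1 + 2 * j) * d * x) ≡ d * ((1 + 2 * j) * ((2 + 2 * j) * x))
  regroup = solve-∀
  swap : ∀ d a b x → d * (a * (b * x)) ≡ d * (b * (a * x))
  swap = solve-∀
  pull : ∀ d a b x → d * (a * (b * x)) ≡ a * b * (d * x)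
  pull = solve-∀

involutions-beyond : ∀ {n N j} → n < 2 * N → N ≤ j → involutions n j ≡ 0
involutions-beyond {n} {N} {j} n<2N N≤j = involutions-vanish {n} {j} (<-≤-trans n<2N (*-monoʳ-≤ 2 N≤j))

n<2*[1+n] : ∀ n → n < 2 * suc n
n<2*[1+n] n = ≤-trans (n<1+n n) (m≤n*m (suc n) 2)

moment-stable : ∀ n α β {N N′} → n < 2 * N → N ≤ N′ →
                sumBelow N′ (λ j → (2 * j + α) ^ β * involutions n j) ≡ sumBelow N (λ j → (2 * j + α) ^ β * involutions n j)
moment-stable n α β {N} n<2N = sumBelow-stable _ vanish
  where
  vanish : ∀ {j} → N ≤ j → (2 * j + α) ^ β * involutions n j ≡ 0
  vanish {j} N≤j = trans (cong ((2 * j + α) ^ β *_) (involutions-beyond n<2N N≤j)) (*-zeroʳ ((2 * j + α) ^ β))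

-- Opaque so that conversion checking never unfolds these sums.
opaque
  telephone : ℕ → ℕ
  telephone n = sumBelow (suc n) (involutions n)

  moment : ℕ → ℕ → ℕ → ℕ
  moment n α β = sumBelow (suc n) (λ j → (2 * j + α) ^ β * involutions n j)

opaque
  unfolding moment telephone

  telephone-0 : telephone 0 ≡ 1
  telephone-0 = refl

  telephone-1 : telephone 1 ≡ 1
  telephone-1 = refl

  moment-zero : ∀ n α → moment n α 0 ≡ telephone n
  moment-zero n α = sumBelow-cong (suc n) (λ j → *-identityˡ (involutions n j))

  moment-one : ∀ α β → moment 1 α β ≡ α ^ β
  moment-one α β = trans (cong₂ _+_ (*-identityʳ (α ^ β)) (*-zeroʳ ((2 + α) ^ β))) (+-identityʳ (α ^ β))

  telephone-suc : ∀ n → telephone (2 + n) ≡ telephone (suc n) + suc n * telephone n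
  telephone-suc n = begin
    telephone (2 + n)                                                   ≡⟨ sumBelow-suc (2 + n) (involutions (2 + n)) ⟩
    1 + sumBelow (2 + n) (λ j → involutions (2 + n) (suc j))           ≡⟨ cong (1 +_) (sumBelow-cong (2 + n) (involutions-suc n)) ⟩
    1 + sumBelow (2 + n) (λ j → fixed j + paired j)                    ≡⟨ cong (1 +_) (sumBelow-+ (2 + n) fixed paired) ⟩
    1 + (sumBelow (2 + n) fixed + sumBelow (2 + n) paired)             ≡⟨ sym (+-assoc 1 (sumBelow (2 + n) fixed) (sumBelow (2 + n) paired)) ⟩
    1 + sumBelow (2 + n) fixed + sumBelow (2 + n) paired
      ≡⟨ cong (λ x → 1 + x + sumBelow (2 + n) paired) (sumBelow-stable fixed fixed-vanish (n≤1+n (suc n))) ⟩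
    1 + sumBelow (suc n) fixed + sumBelow (2 + n) paired               ≡⟨ cong (_+ sumBelow (2 + n) paired) (sym (sumBelow-suc (suc n) (involutions (suc n)))) ⟩
    telephone (suc n) + sumBelow (2 + n) paired                        ≡⟨ cong (telephone (suc n) +_) (sumBelow-*ˡ (2 + n) (suc n) (involutions n)) ⟩
    telephone (suc n) + suc n * sumBelow (2 + n) (involutions n)
      ≡⟨ cong (λ x → telephone (suc n) + suc n * x) (sumBelow-stable (involutions n) (involutions-beyond (n<2*[1+n] n)) (n≤1+n (suc n))) ⟩
    telephone (suc n) + suc n * telephone n ∎
    where
    fixed paired : ℕ → ℕ
    fixed j  = involutions (suc n) (suc j)
    paired j = suc n * involutions n j
    fixed-vanish : ∀ {j} → suc n ≤ j → fixed j ≡ 0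
    fixed-vanish 1+n≤j = involutions-beyond (n<2*[1+n] (suc n)) (s≤s 1+n≤j)

  moment-suc : ∀ n α β → moment (2 + n) α (suc β) ≡ α * moment (2 + n) α β + (2 + n) * suc n * moment n (2 + α) β
  moment-suc n α β = begin
    moment (2 + n) α (suc β)                                               ≡⟨ sumBelow-cong (3 + n) (λ j → split (2 * j) α (w j) (I j)) ⟩
    sumBelow (3 + n) (λ j → α * (w j * I j) + 2 * j * (w j * I j))         ≡⟨ sumBelow-+ (3 + n) (λ j → α * (w j * I j)) (λ j → 2 * j * (w j * I j)) ⟩
    sumBelow (3 + n) (λ j → α * (w j * I j)) + sumBelow (3 + n) (λ j → 2 * j * (w j * I j))
      ≡⟨ cong₂ _+_ (sumBelow-*ˡ (3 + n) α (λ j → w j * I j)) (sumBelow-suc (2 + n) (λ j → 2 * j * (w j * I j))) ⟩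
    α * moment (2 + n) α β + sumBelow (2 + n) (λ j → 2 * suc j * (w (suc j) * I (suc j)))
      ≡⟨ cong (α * moment (2 + n) α β +_) (sumBelow-cong (2 + n) shifted-term) ⟩
    α * moment (2 + n) α β + sumBelow (2 + n) (λ j → c * ((2 * j + (2 + α)) ^ β * involutions n j))
      ≡⟨ cong (α * moment (2 + n) α β +_) (sumBelow-*ˡ (2 + n) c (λ j → (2 * j + (2 + α)) ^ β * involutions n j)) ⟩
    α * moment (2 + n) α β + c * sumBelow (2 + n) (λ j → (2 * j + (2 + α)) ^ β * involutions n j)
      ≡⟨ cong (λ x → α * moment (2 + n) α β + c * x) (moment-stable n (2 + α) β (n<2*[1+n] n) (n≤1+n (suc n))) ⟩
    α * moment (2 + n) α β + c * moment n (2 + α) β ∎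
    where
    c : ℕ
    c = (2 + n) * suc n
    w : ℕ → ℕ
    w j = (2 * j + α) ^ β
    I : ℕ → ℕ
    I = involutions (2 + n)
    split : ∀ x α v i → (x + α) * v * i ≡ α * (v * i) + x * (v * i)
    split = solve-∀
    swap : ∀ x v i → x * (v * i) ≡ v * (x * i)
    swap = solve-∀
    shift : ∀ j α → 2 * suc j + α ≡ 2 * j + (2 + α)
    shift = solve-∀
    shifted-term : ∀ j → 2 * suc j * (w (suc j) * I (suc j)) ≡ c * ((2 * j + (2 + α)) ^ β * involutions n j)
    shifted-term j = begin
      2 * suc j * (w (suc j) * I (suc j))                     ≡⟨ swap (2 * suc j) (w (suc j)) (I (suc j)) ⟩
      w (suc j) * (2 * suc j * I (suc j))                     ≡⟨ cong₂ _*_ (cong (_^ β) (shift j α)) (involutions-absorb n j) ⟩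
      (2 * j + (2 + α)) ^ β * (c * involutions n j)           ≡⟨ swap c ((2 * j + (2 + α)) ^ β) (involutions n j) ⟨
      c * ((2 * j + (2 + α)) ^ β * involutions n j) ∎

telephone-3+ : ∀ n → telephone (3 + n) ≡ (3 + n) * telephone (suc n) + suc n * telephone n
telephone-3+ n = begin
  telephone (3 + n)                                          ≡⟨ telephone-suc (suc n) ⟩
  telephone (2 + n) + (2 + n) * telephone (suc n)            ≡⟨ cong (_+ (2 + n) * telephone (suc n)) (telephone-suc n) ⟩
  telephone (suc n) + suc n * telephone n + (2 + n) * telephone (suc n)
    ≡⟨ collect n (telephone n) (telephone (suc n)) ⟩
  (3 + n) * telephone (suc n) + suc n * telephone n ∎
  where
  collect : ∀ n t₀ t₁ → t₁ + suc n * t₀ + (2 + n) * t₁ ≡ (3 + n) * t₁ + suc n * t₀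
  collect = solve-∀

telephone-4+ : ∀ n → telephone (4 + n) ≡ 2 * (3 + n) * telephone (suc n) + suc n * (4 + n) * telephone n
telephone-4+ n = begin
  telephone (4 + n)                                          ≡⟨ telephone-suc (2 + n) ⟩
  telephone (3 + n) + (3 + n) * telephone (2 + n)            ≡⟨ cong₂ (λ x y → x + (3 + n) * y) (telephone-3+ n) (telephone-suc n) ⟩
  (3 + n) * telephone (suc n) + suc n * telephone n + (3 + n) * (telephone (suc n) + suc n * telephone n)
    ≡⟨ collect n (telephone n) (telephone (suc n)) ⟩
  2 * (3 + n) * telephone (suc n) + suc n * (4 + n) * telephone n ∎
  where
  collect : ∀ n t₀ t₁ → (3 + n) * t₁ + suc n * t₀ + (3 + n) * (t₁ + suc n * t₀) ≡ 2 * (3 + n) * t₁ + suc n * (4 + n) * t₀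
  collect = solve-∀

telephone-5+ : ∀ n → telephone (5 + n) ≡ (3 + n) * (6 + n) * telephone (suc n) + 2 * suc n * (4 + n) * telephone n
telephone-5+ n = begin
  telephone (5 + n)                                          ≡⟨ telephone-suc (3 + n) ⟩
  telephone (4 + n) + (4 + n) * telephone (3 + n)            ≡⟨ cong₂ (λ x y → x + (4 + n) * y) (telephone-4+ n) (telephone-3+ n) ⟩
  2 * (3 + n) * telephone (suc n) + suc n * (4 + n) * telephone n + (4 + n) * ((3 + n) * telephone (suc n) + suc n * telephone n)
    ≡⟨ collect n (telephone n) (telephone (suc n)) ⟩
  (3 + n) * (6 + n) * telephone (suc n) + 2 * suc n * (4 + n) * telephone n ∎
  where
  collect : ∀ n t₀ t₁ → 2 * (3 + n) * t₁ + suc n * (4 + n) * t₀ + (4 + n) * ((3 + n) * t₁ + suc n * t₀)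
                      ≡ (3 + n) * (6 + n) * t₁ + 2 * suc n * (4 + n) * t₀
  collect = solve-∀

-- The extra congruence between the odd parts is what lets the induction on a close. The block is
-- opaque because only the statements matter and unfolding the ring-solver proofs is expensive.
opaque
  telephone-2-adic : ∀ a → ∃[ x ] ∃[ m ] telephone (4 * a) ≡ 2 ^ a * (1 + 2 * x) × telephone (1 + 4 * a) ≡ 2 ^ a * (1 + 2 * x + 8 * m)
  telephone-2-adic zero = 0 , 0 , telephone-0 , telephone-1
  telephone-2-adic (suc a) with telephone-2-adic a
  ... | x , m , t[4a] , t[1+4a] = x′ , m′ , t[4+4a] , t[5+4a]
    where
    P x′ m′ : ℕ
    P = 2 ^ a
    x′ = 4 * a * a + 7 * a + 2 + x * (8 * a * a + 14 * a + 5) + 4 * m * (4 * a + 3)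
    m′ = (a + 1) * ((2 * a + 1) * (1 + 2 * x) + 2 * m * (4 * a + 3))
    identity₄ : ∀ a P x m → 2 * (3 + 4 * a) * (P * (1 + 2 * x + 8 * m)) + (1 + 4 * a) * (4 + 4 * a) * (P * (1 + 2 * x))
              ≡ 2 * P * (1 + 2 * (4 * a * a + 7 * a + 2 + x * (8 * a * a + 14 * a + 5) + 4 * m * (4 * a + 3)))
    identity₄ = solve-∀
    identity₅ : ∀ a P x m → (3 + 4 * a) * (6 + 4 * a) * (P * (1 + 2 * x + 8 * m)) + 2 * (1 + 4 * a) * (4 + 4 * a) * (P * (1 + 2 * x))
              ≡ 2 * P * (1 + 2 * (4 * a * a + 7 * a + 2 + x * (8 * a * a + 14 * a + 5) + 4 * m * (4 * a + 3))
                         + 8 * ((a + 1) * ((2 * a + 1) * (1 + 2 * x) + 2 * m * (4 * a + 3))))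
    identity₅ = solve-∀
    t[4+4a] : telephone (4 * suc a) ≡ 2 ^ suc a * (1 + 2 * x′)
    t[4+4a] = begin
      telephone (4 * suc a)                                   ≡⟨ cong telephone (*-suc 4 a) ⟩
      telephone (4 + 4 * a)                                   ≡⟨ telephone-4+ (4 * a) ⟩
      2 * (3 + 4 * a) * telephone (1 + 4 * a) + (1 + 4 * a) * (4 + 4 * a) * telephone (4 * a)
        ≡⟨ cong₂ (λ t₁ t₀ → 2 * (3 + 4 * a) * t₁ + (1 + 4 * a) * (4 + 4 * a) * t₀) t[1+4a] t[4a] ⟩
      2 * (3 + 4 * a) * (P * (1 + 2 * x + 8 * m)) + (1 + 4 * a) * (4 + 4 * a) * (P * (1 + 2 * x))
        ≡⟨ identity₄ a P x m ⟩
      2 ^ suc a * (1 + 2 * x′) ∎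
    t[5+4a] : telephone (1 + 4 * suc a) ≡ 2 ^ suc a * (1 + 2 * x′ + 8 * m′)
    t[5+4a] = begin
      telephone (1 + 4 * suc a)                               ≡⟨ cong (λ n → telephone (suc n)) (*-suc 4 a) ⟩
      telephone (5 + 4 * a)                                   ≡⟨ telephone-5+ (4 * a) ⟩
      (3 + 4 * a) * (6 + 4 * a) * telephone (1 + 4 * a) + 2 * (1 + 4 * a) * (4 + 4 * a) * telephone (4 * a)
        ≡⟨ cong₂ (λ t₁ t₀ → (3 + 4 * a) * (6 + 4 * a) * t₁ + 2 * (1 + 4 * a) * (4 + 4 * a) * t₀) t[1+4a] t[4a] ⟩
      (3 + 4 * a) * (6 + 4 * a) * (P * (1 + 2 * x + 8 * m)) + 2 * (1 + 4 * a) * (4 + 4 * a) * (P * (1 + 2 * x))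
        ≡⟨ identity₅ a P x m ⟩
      2 ^ suc a * (1 + 2 * x′ + 8 * m′) ∎

  telephone[1+4a] : ∀ a → ∃[ r ] telephone (1 + 4 * a) ≡ 2 ^ a * (1 + 2 * r)
  telephone[1+4a] a with telephone-2-adic a
  ... | x , m , _ , t[1+4a] = x + 4 * m , trans t[1+4a] (cong (2 ^ a *_) (regroup x m))
    where
    regroup : ∀ x m → 1 + 2 * x + 8 * m ≡ 1 + 2 * (x + 4 * m)
    regroup = solve-∀

  telephone[3+4a] : ∀ a → ∃[ q ] telephone (3 + 4 * a) ≡ 2 ^ (2 + a) * (1 + 2 * q)
  telephone[3+4a] a with telephone-2-adic a
  ... | x , m , t[4a] , t[1+4a] = a + x * (2 * a + 1) + m * (4 * a + 3) , (begin
    telephone (3 + 4 * a)                                     ≡⟨ telephone-3+ (4 * a) ⟩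
    (3 + 4 * a) * telephone (1 + 4 * a) + (1 + 4 * a) * telephone (4 * a)
      ≡⟨ cong₂ (λ t₁ t₀ → (3 + 4 * a) * t₁ + (1 + 4 * a) * t₀) t[1+4a] t[4a] ⟩
    (3 + 4 * a) * (2 ^ a * (1 + 2 * x + 8 * m)) + (1 + 4 * a) * (2 ^ a * (1 + 2 * x))
      ≡⟨ identity₃ a (2 ^ a) x m ⟩
    2 ^ (2 + a) * (1 + 2 * (a + x * (2 * a + 1) + m * (4 * a + 3))) ∎)
    where
    identity₃ : ∀ a P x m → (3 + 4 * a) * (P * (1 + 2 * x + 8 * m)) + (1 + 4 * a) * (P * (1 + 2 * x))
              ≡ 2 * (2 * P) * (1 + 2 * (a + x * (2 * a + 1) + m * (4 * a + 3)))
    identity₃ = solve-∀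

moment-5+4a : ∀ a α β → moment (1 + 4 * suc a) α β ≡ moment (5 + 4 * a) α β
moment-5+4a a α β = cong (λ n → moment (suc n) α β) (*-suc 4 a)

2^[2+e]≡4*2^e : ∀ e → 2 ^ (2 + e) ≡ 4 * 2 ^ e
2^[2+e]≡4*2^e e = double-double (2 ^ e)
  where
  double-double : ∀ p → 2 * (2 * p) ≡ 4 * p
  double-double = solve-∀

2^[3+e]≡8*2^e : ∀ e → 2 ^ (3 + e) ≡ 8 * 2 ^ e
2^[3+e]≡8*2^e e = triple-double (2 ^ e)
  where
  triple-double : ∀ p → 2 * (2 * (2 * p)) ≡ 8 * p
  triple-double = solve-∀

2∣[3+4a]*[2+4a] : ∀ a → 2 ∣ (3 + 4 * a) * (2 + 4 * a)
2∣[3+4a]*[2+4a] a = divides ((3 + 4 * a) * (1 + 2 * a)) (factor a)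
  where
  factor : ∀ a → (3 + 4 * a) * (2 + 4 * a) ≡ (3 + 4 * a) * (1 + 2 * a) * 2
  factor = solve-∀

4∣[5+4a]*[4+4a] : ∀ a → 4 ∣ (5 + 4 * a) * (4 + 4 * a)
4∣[5+4a]*[4+4a] a = divides ((5 + 4 * a) * (1 + a)) (factor a)
  where
  factor : ∀ a → (5 + 4 * a) * (4 + 4 * a) ≡ (5 + 4 * a) * (1 + a) * 4
  factor = solve-∀

2^a∣telephone[1+4a] : ∀ a → 2 ^ a ∣ telephone (1 + 4 * a)
2^a∣telephone[1+4a] a with telephone[1+4a] a
... | r , t[1+4a] = subst (2 ^ a ∣_) (sym t[1+4a]) (m∣m*n (1 + 2 * r))

2^[1+a]∣telephone[3+4a] : ∀ a → 2 ^ suc a ∣ telephone (3 + 4 * a)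
2^[1+a]∣telephone[3+4a] a with telephone[3+4a] a
... | q , t[3+4a] = subst (2 ^ suc a ∣_) (sym t[3+4a]) (∣-trans (n∣m*n 2) (m∣m*n (1 + 2 * q)))

mutual
  2^a∣moment[1+4a] : ∀ a α β → 2 ^ a ∣ moment (1 + 4 * a) α β
  2^a∣moment[1+4a] zero    α β       = 1∣ moment 1 α β
  2^a∣moment[1+4a] (suc a) α zero    = subst (2 ^ suc a ∣_) (sym (moment-zero (1 + 4 * suc a) α)) (2^a∣telephone[1+4a] (suc a))
  2^a∣moment[1+4a] (suc a) α (suc β) =
    subst (2 ^ suc a ∣_) (sym (trans (moment-5+4a a α (suc β)) (moment-suc (3 + 4 * a) α β)))
      (∣m∣n⇒∣m+n (∣-trans (subst (2 ^ suc a ∣_) (moment-5+4a a α β) (2^a∣moment[1+4a] (suc a) α β)) (n∣m*n α))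
                 (∣-trans (2^[1+a]∣moment[3+4a] a (2 + α) β) (n∣m*n ((5 + 4 * a) * (4 + 4 * a)))))

  2^[1+a]∣moment[3+4a] : ∀ a α β → 2 ^ suc a ∣ moment (3 + 4 * a) α β
  2^[1+a]∣moment[3+4a] a α zero    = subst (2 ^ suc a ∣_) (sym (moment-zero (3 + 4 * a) α)) (2^[1+a]∣telephone[3+4a] a)
  2^[1+a]∣moment[3+4a] a α (suc β) =
    subst (2 ^ suc a ∣_) (sym (moment-suc (1 + 4 * a) α β))
      (∣m∣n⇒∣m+n (∣-trans (2^[1+a]∣moment[3+4a] a α β) (n∣m*n α))
                 (*-pres-∣ (2∣[3+4a]*[2+4a] a) (2^a∣moment[1+4a] a (2 + α) β)))

opaque
  moment[1+4a]-suc : ∀ a α β → ∃[ E ] 2 ^ (2 + a) ∣ E × moment (1 + 4 * a) α (suc β) ≡ α * moment (1 + 4 * a) α β + E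
  moment[1+4a]-suc zero α β = 0 , (_ ∣0) , (begin
    moment 1 α (suc β)       ≡⟨ moment-one α (suc β) ⟩
    α * α ^ β                ≡⟨ cong (α *_) (moment-one α β) ⟨
    α * moment 1 α β         ≡⟨ +-identityʳ _ ⟨
    α * moment 1 α β + 0     ∎)
  moment[1+4a]-suc (suc a) α β = E , E-divisible , (begin
    moment (1 + 4 * suc a) α (suc β)                           ≡⟨ moment-5+4a a α (suc β) ⟩
    moment (5 + 4 * a) α (suc β)                               ≡⟨ moment-suc (3 + 4 * a) α β ⟩
    α * moment (5 + 4 * a) α β + E                             ≡⟨ cong (λ x → α * x + E) (moment-5+4a a α β) ⟨
    α * moment (1 + 4 * suc a) α β + E ∎)
    where
    E : ℕ
    E = (5 + 4 * a) * (4 + 4 * a) * moment (3 + 4 * a) (2 + α) β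
    E-divisible : 2 ^ (3 + a) ∣ E
    E-divisible = subst (_∣ E) (sym (2^[2+e]≡4*2^e (suc a))) (*-pres-∣ (4∣[5+4a]*[4+4a] a) (2^[1+a]∣moment[3+4a] a (2 + α) β))

  -- Two steps of moment-suc multiply M β by α² = 1 + 4s(s+1); every other term has a factor
  -- 8 · 2^a or 2 · 2^(a+2).
  moment[3+4a]-period : ∀ a s β → ∃[ E ] 2 ^ (3 + a) ∣ E × moment (3 + 4 * a) (1 + 2 * s) (2 + β) ≡ moment (3 + 4 * a) (1 + 2 * s) β + E
  moment[3+4a]-period a s β = E , E-divisible , (begin
    M (2 + β)                                          ≡⟨ moment-suc (1 + 4 * a) α (suc β) ⟩
    α * M (suc β) + c * M′ (suc β)                     ≡⟨ cong₂ (λ x y → α * x + c * y) (moment-suc (1 + 4 * a) α β) M′-suc ⟩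
    α * (α * M β + c * M′ β) + c * ((2 + α) * M′ β + E₁) ≡⟨ expand a s (M β) (M′ β) E₁ ⟩
    M β + E ∎)
    where
    α c : ℕ
    α = 1 + 2 * s
    c = (3 + 4 * a) * (2 + 4 * a)
    M M′ : ℕ → ℕ
    M  = moment (3 + 4 * a) α
    M′ = moment (1 + 4 * a) (2 + α)
    E₁ : ℕ
    E₁ = proj₁ (moment[1+4a]-suc a (2 + α) β)
    E₁-divisible : 2 ^ (2 + a) ∣ E₁
    E₁-divisible = proj₁ (proj₂ (moment[1+4a]-suc a (2 + α) β))
    M′-suc : M′ (suc β) ≡ (2 + α) * M′ β + E₁
    M′-suc = proj₂ (proj₂ (moment[1+4a]-suc a (2 + α) β))
    E : ℕ
    E = 4 * (s * suc s) * M β + 8 * ((3 + 4 * a) * (1 + 2 * a) * suc s) * M′ β + c * E₁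
    expand : ∀ a s X Y E₁ → (1 + 2 * s) * ((1 + 2 * s) * X + (3 + 4 * a) * (2 + 4 * a) * Y) + (3 + 4 * a) * (2 + 4 * a) * ((3 + 2 * s) * Y + E₁)
           ≡ X + (4 * (s * suc s) * X + 8 * ((3 + 4 * a) * (1 + 2 * a) * suc s) * Y + (3 + 4 * a) * (2 + 4 * a) * E₁)
    expand = solve-∀
    E-divisible : 2 ^ (3 + a) ∣ E
    E-divisible = ∣m∣n⇒∣m+n (∣m∣n⇒∣m+n first second) (*-pres-∣ (2∣[3+4a]*[2+4a] a) E₁-divisible)
      where
      first : 2 ^ (3 + a) ∣ 4 * (s * suc s) * M β
      first = subst (_∣ 4 * (s * suc s) * M β) (sym (2^[2+e]≡4*2^e (suc a)))
                    (*-pres-∣ (m∣m*n {4} (s * suc s)) (2^[1+a]∣moment[3+4a] a α β))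
      second : 2 ^ (3 + a) ∣ 8 * ((3 + 4 * a) * (1 + 2 * a) * suc s) * M′ β
      second = subst (_∣ 8 * ((3 + 4 * a) * (1 + 2 * a) * suc s) * M′ β) (sym (2^[3+e]≡8*2^e a))
                     (*-pres-∣ (m∣m*n {8} ((3 + 4 * a) * (1 + 2 * a) * suc s)) (2^a∣moment[1+4a] a (2 + α) β))

ν₂≡-intro : ∀ {x} e q → x ≡ 2 ^ e * (1 + 2 * q) → ν₂≡ x e
ν₂≡-intro e q refl = m∣m*n (1 + 2 * q) , 2^[1+e]∤
  where
  2^[1+e]∤ : ¬ (2 ^ suc e ∣ 2 ^ e * (1 + 2 * q))
  2^[1+e]∤ 2^[1+e]∣ with *-cancelˡ-∣ (2 ^ e) ⦃ m^n≢0 2 e ⦄ (subst (_∣ 2 ^ e * (1 + 2 * q)) (*-comm 2 (2 ^ e)) 2^[1+e]∣)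
  ... | divides k 1+2q≡k*2 = even≢odd k q (trans (*-comm 2 k) (sym 1+2q≡k*2))

ν₂≡-+-high : ∀ {x y} e → ν₂≡ x e → 2 ^ suc e ∣ y → ν₂≡ (x + y) e
ν₂≡-+-high {x} {y} e (2^e∣x , 2^[1+e]∤x) 2^[1+e]∣y =
  ∣m∣n⇒∣m+n 2^e∣x (∣-trans (n∣m*n 2) 2^[1+e]∣y) ,
  λ 2^[1+e]∣x+y → 2^[1+e]∤x (∣m+n∣m⇒∣n (subst (2 ^ suc e ∣_) (+-comm x y) 2^[1+e]∣x+y) 2^[1+e]∣y)

moment[3+4a]-ν₂-zero : ∀ a α → ν₂≡ (moment (3 + 4 * a) α 0) (2 + a)
moment[3+4a]-ν₂-zero a α with telephone[3+4a] a
... | q , t[3+4a] = ν₂≡-intro (2 + a) q (trans (moment-zero (3 + 4 * a) α) t[3+4a])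

moment[3+4a]-ν₂-one : ∀ a α → ν₂≡ (moment (3 + 4 * a) α 1) (suc a)
moment[3+4a]-ν₂-one a α with telephone[1+4a] a | telephone[3+4a] a
... | r , t[1+4a] | q , t[3+4a] =
  subst (λ x → ν₂≡ x (suc a)) (sym moment-expansion) (ν₂≡-+-high (suc a) exact-part higher-part)
  where
  u c : ℕ
  u = 1 + 5 * a + 4 * a * a
  c = (3 + 4 * a) * (2 + 4 * a)
  moment-expansion : moment (3 + 4 * a) α 1 ≡ c * telephone (1 + 4 * a) + α * telephone (3 + 4 * a)
  moment-expansion = begin
    moment (3 + 4 * a) α 1                                             ≡⟨ moment-suc (1 + 4 * a) α 0 ⟩
    α * moment (3 + 4 * a) α 0 + c * moment (1 + 4 * a) (2 + α) 0     ≡⟨ cong₂ (λ x y → α * x + c * y) (moment-zero (3 + 4 * a) α) (moment-zero (1 + 4 * a) (2 + α)) ⟩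
    α * telephone (3 + 4 * a) + c * telephone (1 + 4 * a)             ≡⟨ +-comm (α * telephone (3 + 4 * a)) (c * telephone (1 + 4 * a)) ⟩
    c * telephone (1 + 4 * a) + α * telephone (3 + 4 * a) ∎
  odd-product : ∀ a P r → (3 + 4 * a) * (2 + 4 * a) * (P * (1 + 2 * r)) ≡ 2 * P * (1 + 2 * (r + (1 + 5 * a + 4 * a * a) * (1 + 2 * r)))
  odd-product = solve-∀
  exact-part : ν₂≡ (c * telephone (1 + 4 * a)) (suc a)
  exact-part = ν₂≡-intro (suc a) (r + u * (1 + 2 * r)) (trans (cong (c *_) t[1+4a]) (odd-product a (2 ^ a) r))
  higher-part : 2 ^ (2 + a) ∣ α * telephone (3 + 4 * a)
  higher-part = ∣-trans (subst (2 ^ (2 + a) ∣_) (sym t[3+4a]) (m∣m*n (1 + 2 * q))) (n∣m*n α)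

moment[3+4a]-ν₂ : ∀ a s m → ν₂≡ (moment (3 + 4 * a) (1 + 2 * s) (2 * m)) (2 + a)
                           × ν₂≡ (moment (3 + 4 * a) (1 + 2 * s) (1 + 2 * m)) (suc a)
moment[3+4a]-ν₂ a s zero    = moment[3+4a]-ν₂-zero a (1 + 2 * s) , moment[3+4a]-ν₂-one a (1 + 2 * s)
moment[3+4a]-ν₂ a s (suc m) with moment[3+4a]-ν₂ a s m
... | ν₂-even , ν₂-odd =
  subst (λ β → ν₂≡ (M β) (2 + a)) (sym (*-suc 2 m)) (two-steps (2 + a) (2 * m) ∣-refl ν₂-even) ,
  subst (λ β → ν₂≡ (M β) (suc a)) (sym (cong suc (*-suc 2 m))) (two-steps (suc a) (1 + 2 * m) (n∣m*n 2) ν₂-odd)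
  where
  M : ℕ → ℕ
  M = moment (3 + 4 * a) (1 + 2 * s)
  two-steps : ∀ e β → 2 ^ suc e ∣ 2 ^ (3 + a) → ν₂≡ (M β) e → ν₂≡ (M (2 + β)) e
  two-steps e β 2^[1+e]∣2^[3+a] ν₂-β with moment[3+4a]-period a s β
  ... | E , E-divisible , M[2+β]≡ = subst (λ x → ν₂≡ x e) (sym M[2+β]≡) (ν₂≡-+-high e ν₂-β (∣-trans 2^[1+e]∣2^[3+a] E-divisible))

opaque
  unfolding moment

  F≡moment : ∀ α β a → F α β (suc a) ≡ moment (3 + 4 * a) α β
  F≡moment α β a = begin
    F α β (suc a)                                                         ≡⟨ sumBelow-cong (2 * suc a) summand ⟩
    sumBelow (2 * suc a) (λ j → (2 * j + α) ^ β * involutions (3 + 4 * a) j) ≡⟨ moment-stable (3 + 4 * a) α β 3+4a<2*[2+2a] 2+2a≤4+4a ⟨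
    moment (3 + 4 * a) α β ∎
    where
    summand : ∀ j → (2 * j + α) ^ β * ratio j * ((4 * suc a ∸ 1) C (2 * j)) ≡ (2 * j + α) ^ β * involutions (3 + 4 * a) j
    summand j = trans (*-assoc ((2 * j + α) ^ β) (ratio j) _)
                      (cong₂ (λ d n → (2 * j + α) ^ β * (d * (n C (2 * j)))) (ratio≡oddFactorial j) (cong (_∸ 1) (*-suc 4 a)))
    double : ∀ a → 2 * (2 * suc a) ≡ 4 + 4 * a
    double = solve-∀
    3+4a<2*[2+2a] : 3 + 4 * a < 2 * (2 * suc a)
    3+4a<2*[2+2a] = ≤-reflexive (sym (double a))
    2+2a≤4+4a : 2 * suc a ≤ 4 + 4 * a
    2+2a≤4+4a = ≤-trans (m≤n+m (2 * suc a) (2 * suc a)) (≤-reflexive (trans (sym (*-distribʳ-+ (suc a) 2 2)) (*-suc 4 a)))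

m≡r+2*[m/2] : ∀ {m r} → m % 2 ≡ r → m ≡ r + 2 * (m / 2)
m≡r+2*[m/2] {m} m%2≡r = trans (m≡m%n+[m/n]*n m 2) (cong₂ _+_ m%2≡r (*-comm (m / 2) 2))

mainTheorem17 : ∀ (α β k : ℕ) → α % 2 ≡ 1 → k ≥ 1 →
    (β % 2 ≡ 0 → ν₂≡ (F α β k) (k + 1)) × (β % 2 ≡ 1 → ν₂≡ (F α β k) k)
mainTheorem17 α β zero    _     ()
mainTheorem17 α β (suc a) α-odd _ = even-case , odd-case
  where
  s = α / 2
  F≡ : ∀ β′ → β ≡ β′ → F α β (suc a) ≡ moment (3 + 4 * a) (1 + 2 * s) β′
  F≡ β′ refl = trans (F≡moment α β a) (cong (λ α → moment (3 + 4 * a) α β) (m≡r+2*[m/2] α-odd))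
  even-case : β % 2 ≡ 0 → ν₂≡ (F α β (suc a)) (suc a + 1)
  even-case β-even = subst₂ ν₂≡ (sym (F≡ _ (m≡r+2*[m/2] β-even))) (+-comm 1 (suc a)) (proj₁ (moment[3+4a]-ν₂ a s (β / 2)))
  odd-case : β % 2 ≡ 1 → ν₂≡ (F α β (suc a)) (suc a)
  odd-case β-odd = subst (λ x → ν₂≡ x (suc a)) (sym (F≡ _ (m≡r+2*[m/2] β-odd))) (proj₂ (moment[3+4a]-ν₂ a s (β / 2)))
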